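{- Let $\mathfrak A$ be a J-algebra and $a,b,c,d,u,v,x,y\in A$; assume $c,d$ are functional and $u;v\cdot x;y\le c^{\smile};d$. (i) For all $a,b$: if $u^{\smile};x\cdot v;y^{\smile}\le a^{\smile};b$, then $u;v\cdot x;y\le(u;a^{\smile}\cdot x;b^{\smile});(a;v\cdot b;y)$. (ii) If $a,b$ are functional: if $u^{\smile};x\cdot v;y^{\smile}\le a^{\smile};b$, then $u;v\cdot x;y=(u;a^{\smile}\cdot x;b^{\smile});(a;v\cdot b;y)$. (iii) If $a,b$ are functional and $1=a^{\smile};b$, then $u;v\cdot x;y=(u;a^{\smile}\cdot x;b^{\smile});(a;v\cdot b;y)$.
   Context: A J-algebra is an algebra $\langle A,\cdot,0,1,;,{}^{\smile},1'\rangle$ satisfying for all $x,y,z$: $x\cdot(y\cdot z)=(x\cdot y)\cdot z$, $x\cdot y=y\cdot x$, $x\cdot x=x$, $x;(y;z)=(x;y);z$, $x;1'=x$, $(x\cdot y);z=(x\cdot y);z\cdot y;z$, $x^{\smile\smile}=x$, $(x;y)^{\smile}=y^{\smile};x^{\smile}$, $(x\cdot y)^{\smile}=x^{\smile}\cdot y^{\smile}$, $x;y\cdot z=(z;y^{\smile}\cdot x);(y\cdot x^{\smile};z)\cdot z$, $0\cdot x=0$, $x\cdot1=x$, $x;0=0$. Converse binds tightest, then $;$, then $\cdot$. $x\le y$ means $x\cdot y=x$. An element $p$ is functional if $p^{\smile};p\le1'$. -}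

module Defs where

open import Level using (Level; suc)
open import Relation.Binary.PropositionalEquality using (_≡_)

record JAlgebra (ℓ : Level) : Set (suc ℓ) where
  infixl 6 _·_
  infixl 7 _⨾_
  infix 8 _˘
  field
    A    : Set ℓ
    _·_  : A → A → A
    𝟘    : A
    𝟙    : A
    _⨾_  : A → A → A
    _˘   : A → A
    1'   : A
    ·-assoc  : ∀ x y z → x · (y · z) ≡ (x · y) · z
    ·-comm   : ∀ x y → x · y ≡ y · x
    ·-idem   : ∀ x → x · x ≡ x
    ⨾-assoc  : ∀ x y z → x ⨾ (y ⨾ z) ≡ (x ⨾ y) ⨾ z
    ⨾-idʳ    : ∀ x → x ⨾ 1' ≡ x
    ⨾-·-dist : ∀ x y z → (x · y) ⨾ z ≡ (x · y) ⨾ z · y ⨾ z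
    ˘-invol  : ∀ x → x ˘ ˘ ≡ x
    ˘-⨾      : ∀ x y → (x ⨾ y) ˘ ≡ y ˘ ⨾ x ˘
    ˘-·      : ∀ x y → (x · y) ˘ ≡ x ˘ · y ˘
    dedekind : ∀ x y z → x ⨾ y · z ≡ (z ⨾ y ˘ · x) ⨾ (y · x ˘ ⨾ z) · z
    𝟘-·      : ∀ x → 𝟘 · x ≡ 𝟘
    ·-𝟙      : ∀ x → x · 𝟙 ≡ x
    ⨾-𝟘      : ∀ x → x ⨾ 𝟘 ≡ 𝟘

  infix 4 _≤_
  _≤_ : A → A → Set ℓ
  x ≤ y = x · y ≡ x

  Functional : A → Set ℓ
  Functional p = p ˘ ⨾ p ≤ 1'

-- Let w = u ⨾ v · x ⨾ y.  Because w ≤ c˘ ⨾ d, the modular law factors w as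
-- c˘ ⨾ middle w ⨾ d through the subidentity middle w = c ⨾ w ⨾ d˘ · 1'.  Applied to
-- w ≤ u ⨾ v and w ≤ x ⨾ y it also bounds middle w by R ⨾ R˘ and by Q ⨾ Q˘, where
-- R = restrict u v and Q = restrict x y are the parts of c ⨾ u and c ⨾ x under
-- (v ⨾ d˘)˘ and (y ⨾ d˘)˘.  As c and d are functional, R˘ ⨾ Q ≤ u˘ ⨾ x · v ⨾ y˘ ≤ a˘ ⨾ b,
-- and since a subidentity is below its own square, middle w ≤ R ⨾ a˘ ⨾ b ⨾ Q˘ and hence
-- middle w ≤ K ⨾ K˘ for the part K of R ⨾ a˘ under (b ⨾ Q˘)˘.  Cancelling c and d
-- in c˘ ⨾ K and K˘ ⨾ d gives the two factors.  For functional a and b the reverse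
-- inequality is a direct cancellation.
module Submission where

open import Defs
open import Level using (Level)
open import Data.Product using (_×_; _,_)
open import Relation.Binary.Bundles using (Poset)
open import Relation.Binary.PropositionalEquality
  using (_≡_; refl; sym; trans; cong; cong₂; isEquivalence; module ≡-Reasoning)
import Relation.Binary.Reasoning.PartialOrder as PosetReasoning

module JAlgebraProperties {ℓ : Level} (𝔄 : JAlgebra ℓ) where
  open JAlgebra 𝔄

  ≤-refl : ∀ {x} → x ≤ x
  ≤-refl {x} = ·-idem x

  ≤-reflexive : ∀ {x y} → x ≡ y → x ≤ y
  ≤-reflexive refl = ≤-refl

  ≤-trans : ∀ {x y z} → x ≤ y → y ≤ z → x ≤ z
  ≤-trans {x} {y} {z} x≤y y≤z = begin
    x · z        ≡⟨ cong (_· z) x≤y ⟨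
    x · y · z    ≡⟨ ·-assoc x y z ⟨
    x · (y · z)  ≡⟨ cong (x ·_) y≤z ⟩
    x · y        ≡⟨ x≤y ⟩
    x            ∎
    where open ≡-Reasoning

  ≤-antisym : ∀ {x y} → x ≤ y → y ≤ x → x ≡ y
  ≤-antisym {x} {y} x≤y y≤x = trans (sym x≤y) (trans (·-comm x y) y≤x)

  ≤-poset : Poset ℓ ℓ ℓ
  ≤-poset = record
    { Carrier = A
    ; _≈_ = _≡_
    ; _≤_ = _≤_
    ; isPartialOrder = record
      { isPreorder = record
        { isEquivalence = isEquivalence
        ; reflexive = ≤-reflexive
        ; trans = ≤-trans
        }
      ; antisym = ≤-antisym
      }
    }

  open PosetReasoning ≤-poset public

  x·y≤x : ∀ x y → x · y ≤ x
  x·y≤x x y = begin-equality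
    x · y · x    ≡⟨ ·-assoc x y x ⟨
    x · (y · x)  ≡⟨ cong (x ·_) (·-comm y x) ⟩
    x · (x · y)  ≡⟨ ·-assoc x x y ⟩
    x · x · y    ≡⟨ cong (_· y) (·-idem x) ⟩
    x · y        ∎

  x·y≤y : ∀ x y → x · y ≤ y
  x·y≤y x y = trans (sym (·-assoc x y y)) (cong (x ·_) (·-idem y))

  ·-greatest : ∀ {x y z} → z ≤ x → z ≤ y → z ≤ x · y
  ·-greatest {x} {y} {z} z≤x z≤y = trans (·-assoc z x y) (trans (cong (_· y) z≤x) z≤y)

  x≤𝟙 : ∀ x → x ≤ 𝟙
  x≤𝟙 = ·-𝟙

  ˘-mono : ∀ {x y} → x ≤ y → x ˘ ≤ y ˘
  ˘-mono {x} {y} x≤y = trans (sym (˘-· x y)) (cong _˘ x≤y)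

  ⨾-monoˡ : ∀ {x y z} → x ≤ y → x ⨾ z ≤ y ⨾ z
  ⨾-monoˡ {x} {y} {z} x≤y = begin-equality
    x ⨾ z · y ⨾ z  ≡⟨ cong (λ t → t ⨾ z · y ⨾ z) x≤y ⟨
    (x · y) ⨾ z · y ⨾ z  ≡⟨ ⨾-·-dist x y z ⟨
    (x · y) ⨾ z    ≡⟨ cong (_⨾ z) x≤y ⟩
    x ⨾ z          ∎

  ⨾-monoʳ : ∀ {x y z} → x ≤ y → z ⨾ x ≤ z ⨾ y
  ⨾-monoʳ {x} {y} {z} x≤y = begin
    z ⨾ x          ≡⟨ ˘-invol (z ⨾ x) ⟨
    (z ⨾ x) ˘ ˘    ≡⟨ cong _˘ (˘-⨾ z x) ⟩
    (x ˘ ⨾ z ˘) ˘  ≤⟨ ˘-mono (⨾-monoˡ (˘-mono x≤y)) ⟩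
    (y ˘ ⨾ z ˘) ˘  ≡⟨ cong _˘ (˘-⨾ z y) ⟨
    (z ⨾ y) ˘ ˘    ≡⟨ ˘-invol (z ⨾ y) ⟩
    z ⨾ y          ∎

  ⨾-mono : ∀ {x y z w} → x ≤ y → z ≤ w → x ⨾ z ≤ y ⨾ w
  ⨾-mono x≤y z≤w = ≤-trans (⨾-monoˡ x≤y) (⨾-monoʳ z≤w)

  1'˘≡1' : 1' ˘ ≡ 1'
  1'˘≡1' = begin-equality
    1' ˘             ≡⟨ ⨾-idʳ (1' ˘) ⟨
    1' ˘ ⨾ 1'        ≡⟨ cong (1' ˘ ⨾_) (˘-invol 1') ⟨
    1' ˘ ⨾ 1' ˘ ˘    ≡⟨ ˘-⨾ (1' ˘) 1' ⟨
    (1' ˘ ⨾ 1') ˘    ≡⟨ cong _˘ (⨾-idʳ (1' ˘)) ⟩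
    1' ˘ ˘           ≡⟨ ˘-invol 1' ⟩
    1'               ∎

  ⨾-idˡ : ∀ x → 1' ⨾ x ≡ x
  ⨾-idˡ x = begin-equality
    1' ⨾ x           ≡⟨ ˘-invol (1' ⨾ x) ⟨
    (1' ⨾ x) ˘ ˘     ≡⟨ cong _˘ (˘-⨾ 1' x) ⟩
    (x ˘ ⨾ 1' ˘) ˘   ≡⟨ cong (λ t → (x ˘ ⨾ t) ˘) 1'˘≡1' ⟩
    (x ˘ ⨾ 1') ˘     ≡⟨ cong _˘ (⨾-idʳ (x ˘)) ⟩
    x ˘ ˘            ≡⟨ ˘-invol x ⟩
    x                ∎

  dedekind-≤ : ∀ x y z → x ⨾ y · z ≤ (z ⨾ y ˘ · x) ⨾ (y · x ˘ ⨾ z)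
  dedekind-≤ x y z = ≤-trans (≤-reflexive (dedekind x y z)) (x·y≤x _ _)

  dedekind-≤ˡ : ∀ x y z → x ⨾ y · z ≤ x ⨾ (y · x ˘ ⨾ z)
  dedekind-≤ˡ x y z = ≤-trans (dedekind-≤ x y z) (⨾-monoˡ (x·y≤y _ _))

  dedekind-≤ʳ : ∀ x y z → x ⨾ y · z ≤ (z ⨾ y ˘ · x) ⨾ y
  dedekind-≤ʳ x y z = ≤-trans (dedekind-≤ x y z) (⨾-monoʳ (x·y≤x _ _))

  subidentity-≤-⨾-self : ∀ {e} → e ≤ 1' → e ≤ e ⨾ e
  subidentity-≤-⨾-self {e} e≤1' = begin
    e                                  ≡⟨ e≤1' ⟨
    e · 1'                             ≡⟨ cong (e ·_) (⨾-idʳ 1') ⟨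
    e · 1' ⨾ 1'                        ≡⟨ ·-comm e (1' ⨾ 1') ⟩
    1' ⨾ 1' · e                        ≤⟨ dedekind-≤ 1' 1' e ⟩
    (e ⨾ 1' ˘ · 1') ⨾ (1' · 1' ˘ ⨾ e)  ≡⟨ cong₂ _⨾_ left right ⟩
    e ⨾ e                              ∎
    where
    left : e ⨾ 1' ˘ · 1' ≡ e
    left = trans (cong (λ t → e ⨾ t · 1') 1'˘≡1') (trans (cong (_· 1') (⨾-idʳ e)) e≤1')
    right : 1' · 1' ˘ ⨾ e ≡ e
    right = trans (cong (λ t → 1' · t ⨾ e) 1'˘≡1')
              (trans (cong (1' ·_) (⨾-idˡ e)) (trans (·-comm 1' e) e≤1'))

  subidentity-≤-⨾ : ∀ {e x y} → e ≤ 1' → e ≤ x ⨾ y → e ≤ (y ˘ · x) ⨾ (y ˘ · x) ˘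
  subidentity-≤-⨾ {e} {x} {y} e≤1' e≤x⨾y = begin
    e                                ≤⟨ ·-greatest e≤x⨾y e≤1' ⟩
    x ⨾ y · 1'                       ≤⟨ dedekind-≤ x y 1' ⟩
    (1' ⨾ y ˘ · x) ⨾ (y · x ˘ ⨾ 1')  ≡⟨ cong₂ _⨾_ (cong (_· x) (⨾-idˡ (y ˘))) right ⟩
    (y ˘ · x) ⨾ (y ˘ · x) ˘          ∎
    where
    right : y · x ˘ ⨾ 1' ≡ (y ˘ · x) ˘
    right = trans (cong (y ·_) (⨾-idʳ (x ˘)))
              (trans (cong (_· x ˘) (sym (˘-invol y))) (sym (˘-· (y ˘) x)))

  y˘·x≤x : ∀ x y → y ˘ · x ≤ x
  y˘·x≤x x y = x·y≤y (y ˘) x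

  [y˘·x]˘≤y : ∀ x y → (y ˘ · x) ˘ ≤ y
  [y˘·x]˘≤y x y = ≤-trans (˘-mono (x·y≤x (y ˘) x)) (≤-reflexive (˘-invol y))

  ≤⨾⇒˘≤⨾˘ : ∀ {z x y} → z ≤ x ⨾ y → z ˘ ≤ y ˘ ⨾ x ˘
  ≤⨾⇒˘≤⨾˘ {z} {x} {y} z≤x⨾y = ≤-trans (˘-mono z≤x⨾y) (≤-reflexive (˘-⨾ x y))

  ˘-⨾-˘ : ∀ x y → (x ⨾ y ˘) ˘ ≡ y ⨾ x ˘
  ˘-⨾-˘ x y = trans (˘-⨾ x (y ˘)) (cong (_⨾ x ˘) (˘-invol y))

  ≤-⨾-assocˡ : ∀ {z r s t p} → z ≤ r ⨾ s → t ⨾ r ≤ p → t ⨾ z ≤ p ⨾ s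
  ≤-⨾-assocˡ {z} {r} {s} {t} {p} z≤r⨾s t⨾r≤p = begin
    t ⨾ z        ≤⟨ ⨾-monoʳ z≤r⨾s ⟩
    t ⨾ (r ⨾ s)  ≡⟨ ⨾-assoc t r s ⟩
    t ⨾ r ⨾ s    ≤⟨ ⨾-monoˡ t⨾r≤p ⟩
    p ⨾ s        ∎

  ≤-⨾-assocʳ : ∀ {z r s t q} → z ≤ s ⨾ r → r ⨾ t ≤ q → z ⨾ t ≤ s ⨾ q
  ≤-⨾-assocʳ {z} {r} {s} {t} {q} z≤s⨾r r⨾t≤q = begin
    z ⨾ t        ≤⟨ ⨾-monoˡ z≤s⨾r ⟩
    s ⨾ r ⨾ t    ≡⟨ ⨾-assoc s r t ⟨
    s ⨾ (r ⨾ t)  ≤⟨ ⨾-monoʳ r⨾t≤q ⟩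
    s ⨾ q        ∎

  functional-cancel : ∀ {f p q g h} → Functional f → p ≤ g ⨾ f ˘ → q ≤ f ⨾ h → p ⨾ q ≤ g ⨾ h
  functional-cancel {f} {p} {q} {g} {h} f-fun p≤g⨾f˘ q≤f⨾h = begin
    p ⨾ q                  ≤⟨ ⨾-mono p≤g⨾f˘ q≤f⨾h ⟩
    (g ⨾ f ˘) ⨾ (f ⨾ h)    ≡⟨ ⨾-assoc g (f ˘) (f ⨾ h) ⟨
    g ⨾ (f ˘ ⨾ (f ⨾ h))    ≡⟨ cong (g ⨾_) (⨾-assoc (f ˘) f h) ⟩
    g ⨾ (f ˘ ⨾ f ⨾ h)      ≤⟨ ⨾-monoʳ (⨾-monoˡ f-fun) ⟩
    g ⨾ (1' ⨾ h)           ≡⟨ cong (g ⨾_) (⨾-idˡ h) ⟩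
    g ⨾ h                  ∎

  functional-cancelˡ : ∀ {f q h} → Functional f → q ≤ f ⨾ h → f ˘ ⨾ q ≤ h
  functional-cancelˡ {f} {q} {h} f-fun q≤f⨾h = ≤-trans
    (functional-cancel f-fun (≤-reflexive (sym (⨾-idˡ (f ˘)))) q≤f⨾h)
    (≤-reflexive (⨾-idˡ h))

  functional-cancelʳ : ∀ {f p g} → Functional f → p ≤ g ⨾ f ˘ → p ⨾ f ≤ g
  functional-cancelʳ {f} {p} {g} f-fun p≤g⨾f˘ = ≤-trans
    (functional-cancel f-fun p≤g⨾f˘ (≤-reflexive (sym (⨾-idʳ f))))
    (≤-reflexive (⨾-idʳ g))

  ⨾-·-⨾-functional-≤ : ∀ {a b u v x y} → Functional a → Functional b →
    (u ⨾ a ˘ · x ⨾ b ˘) ⨾ (a ⨾ v · b ⨾ y) ≤ u ⨾ v · x ⨾ y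
  ⨾-·-⨾-functional-≤ a-fun b-fun = ·-greatest
    (functional-cancel a-fun (x·y≤x _ _) (x·y≤x _ _))
    (functional-cancel b-fun (x·y≤y _ _) (x·y≤y _ _))

module FunctionalFactorisation {ℓ : Level} (𝔄 : JAlgebra ℓ) {c d : JAlgebra.A 𝔄}
  (c-fun : JAlgebra.Functional 𝔄 c) (d-fun : JAlgebra.Functional 𝔄 d) where
  open JAlgebra 𝔄
  open JAlgebraProperties 𝔄

  middle : A → A
  middle w = c ⨾ w ⨾ d ˘ · 1'

  restrict : A → A → A
  restrict p q = (q ⨾ d ˘) ˘ · c ⨾ p

  ≤-⨾-middle-⨾ : ∀ {w} → w ≤ c ˘ ⨾ d → w ≤ c ˘ ⨾ middle w ⨾ d
  ≤-⨾-middle-⨾ {w} w≤c˘⨾d = begin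
    w                        ≤⟨ ·-greatest w≤c˘⨾d ≤-refl ⟩
    c ˘ ⨾ d · w              ≤⟨ dedekind-≤ˡ (c ˘) d w ⟩
    c ˘ ⨾ (d · c ˘ ˘ ⨾ w)    ≡⟨ cong (c ˘ ⨾_) (cong₂ _·_ (sym (⨾-idˡ d)) (cong (_⨾ w) (˘-invol c))) ⟩
    c ˘ ⨾ (1' ⨾ d · c ⨾ w)   ≤⟨ ⨾-monoʳ (dedekind-≤ʳ 1' d (c ⨾ w)) ⟩
    c ˘ ⨾ (middle w ⨾ d)     ≡⟨ ⨾-assoc (c ˘) (middle w) d ⟩
    c ˘ ⨾ middle w ⨾ d       ∎

  middle-≤-restrict : ∀ {w p q} → w ≤ p ⨾ q → middle w ≤ restrict p q ⨾ restrict p q ˘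
  middle-≤-restrict {w} {p} {q} w≤p⨾q = subidentity-≤-⨾ (x·y≤y _ _) (begin
    middle w               ≤⟨ x·y≤x _ _ ⟩
    c ⨾ w ⨾ d ˘            ≤⟨ ⨾-monoˡ (⨾-monoʳ w≤p⨾q) ⟩
    c ⨾ (p ⨾ q) ⨾ d ˘      ≡⟨ cong (_⨾ d ˘) (⨾-assoc c p q) ⟩
    c ⨾ p ⨾ q ⨾ d ˘        ≡⟨ ⨾-assoc (c ⨾ p) q (d ˘) ⟨
    (c ⨾ p) ⨾ (q ⨾ d ˘)    ∎)

  restrict-≤ʳ : ∀ p q → restrict p q ≤ c ⨾ p
  restrict-≤ʳ p q = y˘·x≤x (c ⨾ p) (q ⨾ d ˘)

  restrict-≤ˡ : ∀ p q → restrict p q ≤ d ⨾ q ˘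
  restrict-≤ˡ p q = ≤-trans (x·y≤x _ _) (≤-reflexive (˘-⨾-˘ q d))

  restrict˘-≤ : ∀ p q → restrict p q ˘ ≤ q ⨾ d ˘
  restrict˘-≤ p q = [y˘·x]˘≤y (c ⨾ p) (q ⨾ d ˘)

  c˘⨾restrict-≤ : ∀ p q → c ˘ ⨾ restrict p q ≤ p
  c˘⨾restrict-≤ p q = functional-cancelˡ c-fun (restrict-≤ʳ p q)

  restrict˘⨾d-≤ : ∀ p q → restrict p q ˘ ⨾ d ≤ q
  restrict˘⨾d-≤ p q = functional-cancelʳ d-fun (restrict˘-≤ p q)

  restrict˘⨾restrict-≤ : ∀ u v x y → restrict u v ˘ ⨾ restrict x y ≤ u ˘ ⨾ x · v ⨾ y ˘
  restrict˘⨾restrict-≤ u v x y = ·-greatest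
    (functional-cancel c-fun (≤⨾⇒˘≤⨾˘ (restrict-≤ʳ u v)) (restrict-≤ʳ x y))
    (functional-cancel d-fun (restrict˘-≤ u v) (restrict-≤ˡ x y))

  ≤-⨾-factorisation : ∀ {w u v x y a b} → w ≤ c ˘ ⨾ d → w ≤ u ⨾ v → w ≤ x ⨾ y →
    u ˘ ⨾ x · v ⨾ y ˘ ≤ a ˘ ⨾ b → w ≤ (u ⨾ a ˘ · x ⨾ b ˘) ⨾ (a ⨾ v · b ⨾ y)
  ≤-⨾-factorisation {w} {u} {v} {x} {y} {a} {b} w≤c˘⨾d w≤u⨾v w≤x⨾y hyp = begin
    w                                      ≤⟨ ≤-⨾-middle-⨾ w≤c˘⨾d ⟩
    c ˘ ⨾ middle w ⨾ d                     ≤⟨ ⨾-monoˡ (⨾-monoʳ middle≤K⨾K˘) ⟩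
    c ˘ ⨾ (K ⨾ K ˘) ⨾ d                    ≡⟨ cong (_⨾ d) (⨾-assoc (c ˘) K (K ˘)) ⟩
    c ˘ ⨾ K ⨾ K ˘ ⨾ d                      ≡⟨ ⨾-assoc (c ˘ ⨾ K) (K ˘) d ⟨
    (c ˘ ⨾ K) ⨾ (K ˘ ⨾ d)                  ≤⟨ ⨾-mono c˘⨾K-≤ K˘⨾d-≤ ⟩
    (u ⨾ a ˘ · x ⨾ b ˘) ⨾ (a ⨾ v · b ⨾ y)  ∎
    where
    R Q K : A
    R = restrict u v
    Q = restrict x y
    K = (b ⨾ Q ˘) ˘ · R ⨾ a ˘

    middle≤R⨾a˘⨾b⨾Q˘ : middle w ≤ (R ⨾ a ˘) ⨾ (b ⨾ Q ˘)
    middle≤R⨾a˘⨾b⨾Q˘ = begin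
      middle w                 ≤⟨ subidentity-≤-⨾-self (x·y≤y _ _) ⟩
      middle w ⨾ middle w      ≤⟨ ⨾-mono (middle-≤-restrict w≤u⨾v) (middle-≤-restrict w≤x⨾y) ⟩
      (R ⨾ R ˘) ⨾ (Q ⨾ Q ˘)    ≡⟨ ⨾-assoc R (R ˘) (Q ⨾ Q ˘) ⟨
      R ⨾ (R ˘ ⨾ (Q ⨾ Q ˘))    ≡⟨ cong (R ⨾_) (⨾-assoc (R ˘) Q (Q ˘)) ⟩
      R ⨾ (R ˘ ⨾ Q ⨾ Q ˘)      ≤⟨ ⨾-monoʳ (⨾-monoˡ (≤-trans (restrict˘⨾restrict-≤ u v x y) hyp)) ⟩
      R ⨾ (a ˘ ⨾ b ⨾ Q ˘)      ≡⟨ cong (R ⨾_) (⨾-assoc (a ˘) b (Q ˘)) ⟨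
      R ⨾ (a ˘ ⨾ (b ⨾ Q ˘))    ≡⟨ ⨾-assoc R (a ˘) (b ⨾ Q ˘) ⟩
      (R ⨾ a ˘) ⨾ (b ⨾ Q ˘)    ∎

    middle≤K⨾K˘ : middle w ≤ K ⨾ K ˘
    middle≤K⨾K˘ = subidentity-≤-⨾ (x·y≤y _ _) middle≤R⨾a˘⨾b⨾Q˘

    c˘⨾K-≤ : c ˘ ⨾ K ≤ u ⨾ a ˘ · x ⨾ b ˘
    c˘⨾K-≤ = ·-greatest
      (≤-⨾-assocˡ (y˘·x≤x _ _) (c˘⨾restrict-≤ u v))
      (≤-⨾-assocˡ (≤-trans (x·y≤x _ _) (≤-reflexive (˘-⨾-˘ b Q))) (c˘⨾restrict-≤ x y))

    K˘⨾d-≤ : K ˘ ⨾ d ≤ a ⨾ v · b ⨾ y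
    K˘⨾d-≤ = ·-greatest
      (≤-⨾-assocʳ (≤-trans (˘-mono (y˘·x≤x _ _)) (≤-reflexive (˘-⨾-˘ R a))) (restrict˘⨾d-≤ u v))
      (≤-⨾-assocʳ ([y˘·x]˘≤y _ _) (restrict˘⨾d-≤ x y))

proposition59 : ∀ {ℓ : Level} (𝔄 : JAlgebra ℓ) → let open JAlgebra 𝔄 in
    ∀ (c d u v x y : A) → Functional c → Functional d →
    u ⨾ v · x ⨾ y ≤ c ˘ ⨾ d →
      (∀ (a b : A) → u ˘ ⨾ x · v ⨾ y ˘ ≤ a ˘ ⨾ b →
        u ⨾ v · x ⨾ y ≤ (u ⨾ a ˘ · x ⨾ b ˘) ⨾ (a ⨾ v · b ⨾ y))
      × (∀ (a b : A) → Functional a → Functional b → u ˘ ⨾ x · v ⨾ y ˘ ≤ a ˘ ⨾ b →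
        u ⨾ v · x ⨾ y ≡ (u ⨾ a ˘ · x ⨾ b ˘) ⨾ (a ⨾ v · b ⨾ y))
      × (∀ (a b : A) → Functional a → Functional b → 𝟙 ≡ a ˘ ⨾ b →
        u ⨾ v · x ⨾ y ≡ (u ⨾ a ˘ · x ⨾ b ˘) ⨾ (a ⨾ v · b ⨾ y))
proposition59 𝔄 c d u v x y c-fun d-fun w≤c˘⨾d =
    (λ a b → factorisation)
  , (λ a b a-fun b-fun hyp →
       ≤-antisym (factorisation hyp) (⨾-·-⨾-functional-≤ a-fun b-fun))
  , (λ a b a-fun b-fun 𝟙≡a˘⨾b →
       ≤-antisym (factorisation (≤-trans (x≤𝟙 _) (≤-reflexive 𝟙≡a˘⨾b)))
                 (⨾-·-⨾-functional-≤ a-fun b-fun))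
  where
  open JAlgebra 𝔄
  open JAlgebraProperties 𝔄
  open FunctionalFactorisation 𝔄 c-fun d-fun

  factorisation : ∀ {a b} → u ˘ ⨾ x · v ⨾ y ˘ ≤ a ˘ ⨾ b →
    u ⨾ v · x ⨾ y ≤ (u ⨾ a ˘ · x ⨾ b ˘) ⨾ (a ⨾ v · b ⨾ y)
  factorisation = ≤-⨾-factorisation w≤c˘⨾d (x·y≤x _ _) (x·y≤y _ _)
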